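{- For all integers $k\ge 1$ and $n\ge 1$, \[ \bigl|\overline{\mathcal M}^k_n\bigr|=\bigl|\mathcal E^k_n\bigr|=\frac{1}{n}\binom{(k+1)n}{n+1}. \]
   Context: Let $k$ be a positive integer. An elevated $k_0$-Dyck path is a lattice path consisting of up-steps $(1,k)$ and down-steps $(1,-1)$ that starts and ends on the line $y=j$ for some integer $j$ with $0\le j<k$ (the same $j$ at start and end), and stays weakly above the $x$-axis. Let $\mathcal E^k_n$ be the set of elevated $k_0$-Dyck paths with $n$ up-steps (and hence $kn$ down-steps). Let $\mathcal M^k_n$ be the set of $(k+1)\times n$ matrices with entries in $\{0,1\}$ having exactly $n+1$ entries equal to $1$ (and $kn-1$ entries equal to $0$). Two matrices in $\mathcal M^k_n$ are CPC-equivalent if one is obtained from the other by a cyclic permutation of its columns; $\overline{\mathcal M}^k_n$ denotes the set of CPC-equivalence classes of $\mathcal M^k_n$. -}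

module Defs where

open import Data.Nat using (ℕ; zero; suc; _+_; _*_)
open import Data.Bool using (Bool; true; false)
open import Data.Fin using (Fin; toℕ)
open import Data.Vec using (Vec; []; _∷_; _∷ʳ_; map)
open import Data.Product using (Σ; ∃; _×_; _,_)
open import Relation.Binary.PropositionalEquality using (_≡_)
open import Function.Bundles using (_⇔_)

-- Path k h e u : lattice paths with up-steps (1,k) and down-steps (1,-1)
-- starting at height h, ending at height e, with u up-steps, never going
-- below the x-axis (heights are natural numbers; a down-step is only
-- possible from a height ≥ 1).
data Path (k : ℕ) : ℕ → ℕ → ℕ → Set where
  stop : ∀ {h} → Path k h h 0
  up   : ∀ {h e u} → Path k (h + k) e u → Path k h e (suc u)
  down : ∀ {h e u} → Path k h e u → Path k (suc h) e u

Elevated : ℕ → ℕ → Set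
Elevated k n = Σ (Fin k) λ j → Path k (toℕ j) (toℕ j) n

Matrix : ℕ → ℕ → Set
Matrix m n = Vec (Vec Bool n) m

onesRow : ∀ {n} → Vec Bool n → ℕ
onesRow [] = 0
onesRow (true ∷ xs) = suc (onesRow xs)
onesRow (false ∷ xs) = onesRow xs

ones : ∀ {m n} → Matrix m n → ℕ
ones [] = 0
ones (r ∷ rs) = onesRow r + ones rs

MatSet : ℕ → ℕ → Set
MatSet k n = Σ (Matrix (suc k) n) λ A → ones A ≡ suc n

rotate : ∀ {A : Set} {n} → Vec A n → Vec A n
rotate [] = []
rotate (x ∷ xs) = xs ∷ʳ x

rotateN : ∀ {A : Set} {n} → ℕ → Vec A n → Vec A n
rotateN zero xs = xs
rotateN (suc s) xs = rotate (rotateN s xs)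

shiftCols : ∀ {m n} → ℕ → Matrix m n → Matrix m n
shiftCols s A = map (rotateN s) A

CPC : ∀ k n → MatSet k n → MatSet k n → Set
CPC k n (A , _) (B , _) = ∃ λ s → B ≡ shiftCols s A

-- A relation R on a type X has exactly N equivalence classes:
-- there is a surjection cls : X → Fin N whose fibres are exactly the
-- R-classes (i.e. X/R is in bijection with Fin N).
HasClasses : (X : Set) → (X → X → Set) → ℕ → Set
HasClasses X R N =
  Σ (X → Fin N) λ cls →
    (∀ i → ∃ λ x → cls x ≡ i) ×
    (∀ x y → (cls x ≡ cls y) ⇔ R x y)

module Submission where

-- Transposing, a matrix of 𝓜^k_n is a sequence of n columns of height
-- k + 1 holding n + 1 ones, and a cyclic permutation of its columns is
-- a rotation of this sequence.

open import Defs
open import Data.Nat using (ℕ; suc; _*_; _≤_)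
open import Data.Nat.Combinatorics using (_C_)
open import Data.Fin using (Fin)
open import Data.Product using (∃; _×_; _,_)
open import Relation.Binary.PropositionalEquality using (_≡_)
open import Function.Bundles using (_↔_)

module CycleLemma where

  open import Data.Nat
  open import Data.Nat.Properties
  open import Data.Nat.Tactic.RingSolver using (solve-∀)
  open import Data.Product using (Σ; _×_; _,_)
  open import Data.Sum using (inj₁; inj₂)
  open import Data.Empty using (⊥; ⊥-elim)
  open import Relation.Nullary using (yes; no)
  open import Relation.Binary.Definitions using (tri<; tri≈; tri>)
  open import Relation.Binary.PropositionalEquality

  psum : (ℕ → ℕ) → ℕ → ℕ
  psum f zero = 0
  psum f (suc t) = psum f t + f t

  psum-cong : ∀ {f g} t → (∀ i → i < t → f i ≡ g i) → psum f t ≡ psum g t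
  psum-cong zero e = refl
  psum-cong (suc t) e = cong₂ _+_ (psum-cong t (λ i i<t → e i (m<n⇒m<1+n i<t))) (e t ≤-refl)

  psum-split : ∀ f s t → psum f (s + t) ≡ psum f s + psum (λ i → f (s + i)) t
  psum-split f s zero = trans (cong (psum f) (+-identityʳ s)) (sym (+-identityʳ _))
  psum-split f s (suc t) = begin
      psum f (s + suc t)                             ≡⟨ cong (psum f) (+-suc s t) ⟩
      psum f (s + t) + f (s + t)                     ≡⟨ cong (_+ f (s + t)) (psum-split f s t) ⟩
      psum f s + psum (λ i → f (s + i)) t + f (s + t) ≡⟨ +-assoc (psum f s) _ _ ⟩
      psum f s + psum (λ i → f (s + i)) (suc t)        ∎
    where open ≡-Reasoning

  psum-suc : ∀ f t → psum f (suc t) ≡ f 0 + psum (λ i → f (suc i)) t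
  psum-suc f t = psum-split f 1 t

  -- The cycle lemma (Raney).
  module Periodic (f : ℕ → ℕ) (n : ℕ) (periodic : ∀ i → f (i + n) ≡ f i) where

    P : ℕ → ℕ
    P = psum f

    window-sum : ∀ s → psum (λ i → f (s + i)) n ≡ P n
    window-sum zero = refl
    window-sum (suc s) = +-cancelˡ-≡ (f s) _ _ (begin
        f s + psum (λ i → f (suc s + i)) n   ≡⟨ cong (f s +_) (psum-cong n (λ i _ → cong f (sym (+-suc s i)))) ⟩
        f s + psum (λ i → g (suc i)) n        ≡⟨ cong (_+ psum (λ i → g (suc i)) n) (cong f (sym (+-identityʳ s))) ⟩
        g 0 + psum (λ i → g (suc i)) n        ≡⟨ sym (psum-suc g n) ⟩
        psum g n + f (s + n)                  ≡⟨ cong₂ _+_ (window-sum s) (periodic s) ⟩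
        P n + f s                             ≡⟨ +-comm (P n) (f s) ⟩
        f s + P n                             ∎)
      where open ≡-Reasoning
            g = λ i → f (s + i)

    P-periodic : ∀ t → P (t + n) ≡ P t + P n
    P-periodic t = trans (psum-split f t n) (cong (P t +_) (window-sum t))

    Dominating : ℕ → Set
    Dominating r = ∀ t → 1 ≤ t → t ≤ n → P r + t < P (r + t)

    module _ (total : P n ≡ suc n) where

      P-shift : ∀ t → P (t + n) ≡ P t + suc n
      P-shift t = trans (P-periodic t) (cong (P t +_) total)

      -- Two dominating positions a and a + d with d + e = n, d, e ≥ 1,
      -- cannot coexist: the window [a, a + d) has sum > d, the window
      -- [a + d, a + n) has sum > e, yet together they sum to n + 1.
      not-two-dominating : ∀ a d e → 1 ≤ d → 1 ≤ e → n ≡ d + e →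
                           Dominating a → Dominating (a + d) → ⊥
      not-two-dominating a d e 1≤d 1≤e n≡d+e dom-a dom-b =
        <-irrefl refl (<-≤-trans first-window first-window-bound)
        where
        first-window : P a + d < P (a + d)
        first-window = dom-a d 1≤d (subst (d ≤_) (sym n≡d+e) (m≤m+n d e))
        second-window : P (a + d) + e < P a + suc (d + e)
        second-window = subst (P (a + d) + e <_)
          (begin
            P (a + d + e)       ≡⟨ cong P (trans (+-assoc a d e) (cong (a +_) (sym n≡d+e))) ⟩
            P (a + n)           ≡⟨ P-shift a ⟩
            P a + suc n         ≡⟨ cong (λ m → P a + suc m) n≡d+e ⟩
            P a + suc (d + e)   ∎)
          (dom-b e 1≤e (subst (e ≤_) (sym n≡d+e) (m≤n+m e d)))
          where open ≡-Reasoning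
        first-window-bound : P (a + d) ≤ P a + d
        first-window-bound = +-cancelʳ-≤ e _ _ (s≤s⁻¹ (subst (P (a + d) + e <_)
          (trans (+-suc (P a) (d + e)) (cong suc (sym (+-assoc (P a) d e)))) second-window))

      no-dominating-pair : ∀ a b → a < b → b < n → Dominating a → Dominating b → ⊥
      no-dominating-pair a b a<b b<n dom-a dom-b =
        not-two-dominating a (b ∸ a) (n ∸ (b ∸ a)) (m<n⇒0<n∸m a<b) (m<n⇒0<n∸m d<n)
          (sym (m+[n∸m]≡n (<⇒≤ d<n))) dom-a (subst Dominating (sym (m+[n∸m]≡n (<⇒≤ a<b))) dom-b)
        where d<n = ≤-<-trans (m∸n≤m b a) b<n

      dominating-unique : ∀ a b → a < n → b < n → Dominating a → Dominating b → a ≡ b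
      dominating-unique a b a<n b<n dom-a dom-b with <-cmp a b
      ... | tri≈ _ a≡b _ = a≡b
      ... | tri< a<b _ _ = ⊥-elim (no-dominating-pair a b a<b b<n dom-a dom-b)
      ... | tri> _ _ b<a = ⊥-elim (no-dominating-pair b a b<a a<n dom-b dom-a)

      -- Existence: the last position r ≤ m at which  P u ∸ u  is minimal,
      -- phrased without subtraction.
      record LastMinimum (m : ℕ) : Set where
        field
          pos            : ℕ
          pos≤m          : pos ≤ m
          minimal        : ∀ u → u ≤ m → P pos + u ≤ P u + pos
          strictly-after : ∀ u → pos < u → u ≤ m → P pos + u < P u + pos

      excess-trans : ∀ a b c → P a + b ≤ P b + a → P b + c ≤ P c + b → P a + c ≤ P c + a
      excess-trans a b c ab bc = +-cancelʳ-≤ (P b + b) _ _ (begin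
          P a + c + (P b + b)     ≡⟨ rearrange (P a) (P b) b c ⟩
          (P a + b) + (P b + c)   ≤⟨ +-mono-≤ ab bc ⟩
          (P b + a) + (P c + b)   ≡⟨ rearrange′ (P b) (P c) a b ⟩
          P c + a + (P b + b)     ∎)
        where
        open ≤-Reasoning
        rearrange : ∀ pa pb b c → pa + c + (pb + b) ≡ (pa + b) + (pb + c)
        rearrange = solve-∀
        rearrange′ : ∀ pb pc a b → (pb + a) + (pc + b) ≡ pc + a + (pb + b)
        rearrange′ = solve-∀

      last-minimum : ∀ m → LastMinimum m
      last-minimum zero = record
        { pos = 0 ; pos≤m = z≤n ; minimal = λ { u z≤n → ≤-refl }
        ; strictly-after = λ { u 0<u z≤n → ⊥-elim (<-irrefl refl 0<u) } }
      last-minimum (suc m) with last-minimum m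
      ... | lm with P (suc m) + LastMinimum.pos lm ≤? P (LastMinimum.pos lm) + suc m
      ... | yes new-min = record
        { pos = suc m ; pos≤m = ≤-refl ; minimal = minimal′
        ; strictly-after = λ u m<u u≤m → ⊥-elim (<-irrefl refl (<-≤-trans m<u u≤m)) }
        where
        open LastMinimum lm
        minimal′ : ∀ u → u ≤ suc m → P (suc m) + u ≤ P u + suc m
        minimal′ u u≤ with m≤n⇒m<n∨m≡n u≤
        ... | inj₂ refl = ≤-refl
        ... | inj₁ u<   = excess-trans (suc m) pos u new-min (minimal u (s≤s⁻¹ u<))
      ... | no old-min = record
        { pos = pos ; pos≤m = m≤n⇒m≤1+n pos≤m ; minimal = minimal′ ; strictly-after = strictly-after′ }
        where
        open LastMinimum lm
        below : P pos + suc m < P (suc m) + pos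
        below = ≰⇒> old-min
        minimal′ : ∀ u → u ≤ suc m → P pos + u ≤ P u + pos
        minimal′ u u≤ with m≤n⇒m<n∨m≡n u≤
        ... | inj₂ refl = <⇒≤ below
        ... | inj₁ u<   = minimal u (s≤s⁻¹ u<)
        strictly-after′ : ∀ u → pos < u → u ≤ suc m → P pos + u < P u + pos
        strictly-after′ u pos<u u≤ with m≤n⇒m<n∨m≡n u≤
        ... | inj₂ refl = below
        ... | inj₁ u<   = strictly-after u pos<u (s≤s⁻¹ u<)

      -- The last minimum over one period is dominating: a window ending
      -- inside the period is handled by strict minimality, a window
      -- wrapping around by minimality and periodicity.
      dominating-exists : ∀ n′ → n ≡ suc n′ → Σ ℕ λ r → r < n × Dominating r
      dominating-exists n′ n≡ = pos , subst (pos <_) (sym n≡) (s≤s pos≤m) , dominating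
        where
        open LastMinimum (last-minimum n′)
        dominating : Dominating pos
        dominating t 1≤t t≤n with pos + t ≤? n′
        ... | yes inside = +-cancelʳ-< pos _ _
          (subst (_< P (pos + t) + pos) (rearrange (P pos) pos t)
            (strictly-after (pos + t) (m<m+n pos 1≤t) inside))
          where
          rearrange : ∀ p r t → p + (r + t) ≡ p + t + r
          rearrange = solve-∀
        ... | no outside = +-cancelʳ-< pos _ _ (begin-strict
            P pos + t + pos     ≡⟨ rearrange (P pos) t pos ⟩
            P pos + (pos + t)   ≡⟨ cong (P pos +_) (sym v+n) ⟩
            P pos + (v + n)     ≡⟨ sym (+-assoc (P pos) v n) ⟩
            P pos + v + n       ≤⟨ +-monoˡ-≤ n (minimal v v≤n′) ⟩
            P v + pos + n       <⟨ n<1+n _ ⟩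
            suc (P v + pos + n) ≡⟨ rearrange′ (P v) pos n ⟩
            P v + suc n + pos   ≡⟨ cong (_+ pos) (sym (trans (cong P (sym v+n)) (P-shift v))) ⟩
            P (pos + t) + pos   ∎)
          where
          open ≤-Reasoning
          n≤ : n ≤ pos + t
          n≤ = subst (_≤ pos + t) (sym n≡) (≰⇒> outside)
          v = pos + t ∸ n
          v+n : v + n ≡ pos + t
          v+n = m∸n+n≡m n≤
          v≤n′ : v ≤ n′
          v≤n′ = ≤-trans (+-cancelʳ-≤ n v pos (subst (_≤ pos + n) (sym v+n) (+-monoʳ-≤ pos t≤n))) pos≤m
          rearrange : ∀ p t r → p + t + r ≡ p + (r + t)
          rearrange = solve-∀
          rearrange′ : ∀ pv r n → suc (pv + r + n) ≡ pv + suc n + r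
          rearrange′ = solve-∀

module Rotations where

  open import Data.Nat
  open import Data.Nat.Properties
  open import Data.Nat.Tactic.RingSolver using (solve-∀)
  open import Data.Bool using (Bool; true; false)
  open import Data.Vec as V using (Vec; []; _∷_; _∷ʳ_; map; zipWith; replicate; toList)
  open import Data.Vec.Properties using (toList-injective; cast-is-id; toList-∷ʳ; map-∷ʳ; map-∘; map-id; length-toList)
  open import Data.List as L using (List; _++_; length)
  open import Data.List.Properties using (++-identityʳ; ++-assoc)
  open import Function using (_∘_)
  open import Relation.Binary.PropositionalEquality

  private variable
    A B : Set
    m n : ℕ

  rotateN-+ : ∀ s t (xs : Vec A n) → rotateN s (rotateN t xs) ≡ rotateN (s + t) xs
  rotateN-+ zero t xs = refl
  rotateN-+ (suc s) t xs = cong rotate (rotateN-+ s t xs)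

  rotate-map : ∀ (f : A → B) (xs : Vec A n) → rotate (map f xs) ≡ map f (rotate xs)
  rotate-map f [] = refl
  rotate-map f (x ∷ xs) = sym (map-∷ʳ f x xs)

  rotateN-map : ∀ s (f : A → B) (xs : Vec A n) → rotateN s (map f xs) ≡ map f (rotateN s xs)
  rotateN-map zero f xs = refl
  rotateN-map (suc s) f xs = trans (cong rotate (rotateN-map s f xs)) (rotate-map f (rotateN s xs))

  -- Rotation of lists: vector rotations are computed through toList,
  -- where prefixes and suffixes can be split freely.
  rotateL : List A → List A
  rotateL L.[] = L.[]
  rotateL (x L.∷ l) = l ++ L.[ x ]

  rotateLN : ℕ → List A → List A
  rotateLN zero l = l
  rotateLN (suc s) l = rotateL (rotateLN s l)

  rotateLN-suc : ∀ s (l : List A) → rotateLN (suc s) l ≡ rotateLN s (rotateL l)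
  rotateLN-suc zero l = refl
  rotateLN-suc (suc s) l = cong rotateL (rotateLN-suc s l)

  toList-rotateN : ∀ s (xs : Vec A n) → toList (rotateN s xs) ≡ rotateLN s (toList xs)
  toList-rotateN zero xs = refl
  toList-rotateN (suc s) xs = trans (toList-rotate (rotateN s xs)) (cong rotateL (toList-rotateN s xs))
    where
    toList-rotate : ∀ {n} (xs : Vec A n) → toList (rotate xs) ≡ rotateL (toList xs)
    toList-rotate [] = refl
    toList-rotate (x ∷ xs) = toList-∷ʳ x xs

  rotateLN-++ : ∀ (xs ys : List A) → rotateLN (length xs) (xs ++ ys) ≡ ys ++ xs
  rotateLN-++ L.[] ys = sym (++-identityʳ ys)
  rotateLN-++ (x L.∷ xs) ys = begin
      rotateLN (suc (length xs)) (x L.∷ xs ++ ys) ≡⟨ rotateLN-suc (length xs) (x L.∷ xs ++ ys) ⟩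
      rotateLN (length xs) ((xs ++ ys) ++ L.[ x ]) ≡⟨ cong (rotateLN (length xs)) (++-assoc xs ys L.[ x ]) ⟩
      rotateLN (length xs) (xs ++ ys ++ L.[ x ]) ≡⟨ rotateLN-++ xs (ys ++ L.[ x ]) ⟩
      (ys ++ L.[ x ]) ++ xs                      ≡⟨ ++-assoc ys L.[ x ] xs ⟩
      ys ++ x L.∷ xs                             ∎
    where open ≡-Reasoning

  rotateN-period : ∀ (xs : Vec A n) → rotateN n xs ≡ xs
  rotateN-period {n = n} xs = trans (sym (cast-is-id refl _)) (toList-injective refl _ _ (begin
      toList (rotateN n xs)                              ≡⟨ toList-rotateN n xs ⟩
      rotateLN n (toList xs)                             ≡⟨ cong (λ m → rotateLN m (toList xs)) (sym (length-toList xs)) ⟩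
      rotateLN (length (toList xs)) (toList xs)          ≡⟨ cong (rotateLN (length (toList xs))) (sym (++-identityʳ (toList xs))) ⟩
      rotateLN (length (toList xs)) (toList xs ++ L.[])  ≡⟨ rotateLN-++ (toList xs) L.[] ⟩
      toList xs                                          ∎))
    where open ≡-Reasoning

  rotateN-multiple : ∀ q (xs : Vec A n) → rotateN (q * n) xs ≡ xs
  rotateN-multiple zero xs = refl
  rotateN-multiple {n = n} (suc q) xs = begin
      rotateN (n + q * n) xs              ≡⟨ sym (rotateN-+ n (q * n) xs) ⟩
      rotateN n (rotateN (q * n) xs)      ≡⟨ cong (rotateN n) (rotateN-multiple q xs) ⟩
      rotateN n xs                        ≡⟨ rotateN-period xs ⟩
      xs                                  ∎
    where open ≡-Reasoning

  rotateN-mod : ∀ s q (xs : Vec A n) → rotateN (s + q * n) xs ≡ rotateN s xs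
  rotateN-mod s q xs = trans (sym (rotateN-+ s _ xs)) (cong (rotateN s) (rotateN-multiple q xs))

  rotateN-inverse : ∀ r s (xs : Vec A n) → r + s ≡ n → rotateN r (rotateN s xs) ≡ xs
  rotateN-inverse r s xs r+s≡n = trans (rotateN-+ r s xs) (trans (cong (λ m → rotateN m xs) r+s≡n) (rotateN-period xs))

  -- Transposition turns the m rows of a matrix into its n columns, so
  -- that a cyclic shift of the columns becomes a rotation of a vector.
  transpose : Vec (Vec A m) n → Vec (Vec A n) m
  transpose [] = replicate _ []
  transpose (r ∷ rs) = zipWith _∷_ r (transpose rs)

  transpose-involutive : ∀ (M : Vec (Vec A m) n) → transpose (transpose M) ≡ M
  transpose-involutive [] = vec0 _
    where
    vec0 : (xs : Vec A 0) → xs ≡ []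
    vec0 [] = refl
  transpose-involutive (r ∷ M) = trans (transpose-zip r (transpose M)) (cong (r ∷_) (transpose-involutive M))
    where
    transpose-zip : ∀ {m n} (x : Vec A n) (M : Vec (Vec A m) n) → transpose (zipWith _∷_ x M) ≡ x ∷ transpose M
    transpose-zip [] [] = refl
    transpose-zip (a ∷ x) (r ∷ M) = cong (zipWith _∷_ (a ∷ r)) (transpose-zip x M)

  transpose-rotate : ∀ (M : Vec (Vec A m) n) → transpose (map rotate M) ≡ rotate (transpose M)
  transpose-rotate {m = m} [] = sym (rotate-replicate m)
    where
    rotate-replicate : ∀ m → rotate {n = m} (replicate m []) ≡ replicate m []
    rotate-replicate zero = refl
    rotate-replicate (suc m) = snoc-replicate m
      where
      snoc-replicate : ∀ m → replicate m [] ∷ʳ [] ≡ [] ∷ replicate m []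
      snoc-replicate zero = refl
      snoc-replicate (suc m) = cong ([] ∷_) (snoc-replicate m)
  transpose-rotate (r ∷ M) = trans (cong (zipWith _∷_ (rotate r)) (transpose-rotate M)) (sym (rotate-zipWith r (transpose M)))
    where
    rotate-zipWith : ∀ {m n} (xs : Vec A n) (ys : Vec (Vec A m) n) →
                     rotate (zipWith _∷_ xs ys) ≡ zipWith _∷_ (rotate xs) (rotate ys)
    rotate-zipWith [] [] = refl
    rotate-zipWith (x ∷ xs) (y ∷ ys) = sym (zipWith-∷ʳ xs ys x y)
      where
      zipWith-∷ʳ : ∀ {m n} (xs : Vec A n) (ys : Vec (Vec A m) n) x y →
                   zipWith _∷_ (xs ∷ʳ x) (ys ∷ʳ y) ≡ zipWith _∷_ xs ys ∷ʳ (x ∷ y)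
      zipWith-∷ʳ [] [] x y = refl
      zipWith-∷ʳ (a ∷ xs) (b ∷ ys) x y = cong ((a ∷ b) ∷_) (zipWith-∷ʳ xs ys x y)

  transpose-shiftCols : ∀ s (M : Vec (Vec Bool m) n) → transpose (shiftCols s M) ≡ rotateN s (transpose M)
  transpose-shiftCols zero M = cong transpose (map-id M)
  transpose-shiftCols (suc s) M = begin
      transpose (map (rotate ∘ rotateN s) M)    ≡⟨ cong transpose (map-∘ rotate (rotateN s) M) ⟩
      transpose (map rotate (shiftCols s M))   ≡⟨ transpose-rotate (shiftCols s M) ⟩
      rotate (transpose (shiftCols s M))       ≡⟨ cong rotate (transpose-shiftCols s M) ⟩
      rotate (rotateN s (transpose M))         ∎
    where open ≡-Reasoning

  ones-rotateN : ∀ s (M : Vec (Vec Bool m) n) → ones (rotateN s M) ≡ ones M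
  ones-rotateN zero M = refl
  ones-rotateN (suc s) M = trans (ones-rotate (rotateN s M)) (ones-rotateN s M)
    where
    ones-∷ʳ : ∀ {m n} (M : Vec (Vec Bool m) n) r → ones (M ∷ʳ r) ≡ ones M + onesRow r
    ones-∷ʳ [] r = +-identityʳ _
    ones-∷ʳ (x ∷ M) r = trans (cong (onesRow x +_) (ones-∷ʳ M r)) (sym (+-assoc (onesRow x) _ _))
    ones-rotate : ∀ {m n} (M : Vec (Vec Bool m) n) → ones (rotate M) ≡ ones M
    ones-rotate [] = refl
    ones-rotate (x ∷ M) = trans (ones-∷ʳ M x) (+-comm (ones M) (onesRow x))

  ones-transpose : ∀ (M : Vec (Vec Bool m) n) → ones (transpose M) ≡ ones M
  ones-transpose {m = m} [] = ones-empty m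
    where
    ones-empty : ∀ m → ones {m} {0} (replicate m []) ≡ 0
    ones-empty zero = refl
    ones-empty (suc m) = ones-empty m
  ones-transpose (r ∷ M) = trans (ones-zip r (transpose M)) (cong (onesRow r +_) (ones-transpose M))
    where
    swap-middle : ∀ a b c → a + (b + c) ≡ b + (a + c)
    swap-middle = solve-∀
    ones-zip : ∀ {m n} (x : Vec Bool n) (M : Vec (Vec Bool m) n) → ones (zipWith _∷_ x M) ≡ onesRow x + ones M
    ones-zip [] [] = refl
    ones-zip (true ∷ x) (r ∷ M) = cong suc (trans (cong (onesRow r +_) (ones-zip x M)) (swap-middle (onesRow r) (onesRow x) (ones M)))
    ones-zip (false ∷ x) (r ∷ M) = trans (cong (onesRow r +_) (ones-zip x M)) (swap-middle (onesRow r) (onesRow x) (ones M))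

module CanonicalRotation where

  open CycleLemma
  open Rotations
  open import Data.Nat
  open import Data.Nat.Properties
  open import Data.Nat.DivMod using (_%_; _/_; m≡m%n+[m/n]*n; m%n<n)
  open import Data.Nat.ListAction using (sum)
  open import Data.Bool using (Bool)
  open import Data.Vec as V using (Vec; []; _∷_; head; toList)
  open import Data.Vec.Properties using (length-toList)
  open import Data.List as L using (List; length)
  open import Data.List.Properties using (length-++)
  open import Data.Product using (proj₁; proj₂)
  open import Axiom.UniquenessOfIdentityProofs.WithK using (uip)
  open import Relation.Binary.PropositionalEquality

  private variable
    A : Set
    c n′ : ℕ

  nthOr : A → List A → ℕ → A
  nthOr d L.[] i = d
  nthOr d (x L.∷ l) zero = x
  nthOr d (x L.∷ l) (suc i) = nthOr d l i

  nthOr-rotateLN : ∀ (d : A) i l → i < length l → nthOr d (rotateLN i l) 0 ≡ nthOr d l i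
  nthOr-rotateLN d zero l i<l = refl
  nthOr-rotateLN d (suc i) (x L.∷ l) (s≤s i<l) = begin
      nthOr d (rotateLN (suc i) (x L.∷ l)) 0   ≡⟨ cong (λ z → nthOr d z 0) (rotateLN-suc i (x L.∷ l)) ⟩
      nthOr d (rotateLN i (l L.++ L.[ x ])) 0  ≡⟨ nthOr-rotateLN d i (l L.++ L.[ x ]) i<l++x ⟩
      nthOr d (l L.++ L.[ x ]) i               ≡⟨ nthOr-++ l i<l ⟩
      nthOr d l i                              ∎
    where
    open ≡-Reasoning
    i<l++x : i < length (l L.++ L.[ x ])
    i<l++x = <-≤-trans (m<n⇒m<1+n i<l) (≤-reflexive (sym (trans (length-++ l) (+-comm (length l) 1))))
    nthOr-++ : ∀ l {l′} {i} → i < length l → nthOr d (l L.++ l′) i ≡ nthOr d l i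
    nthOr-++ (y L.∷ l) {i = zero} _ = refl
    nthOr-++ (y L.∷ l) {i = suc i} (s≤s i<l) = nthOr-++ l i<l

  psum-nthOr : ∀ (l : List ℕ) → psum (nthOr 0 l) (length l) ≡ sum l
  psum-nthOr L.[] = refl
  psum-nthOr (x L.∷ l) = trans (psum-suc _ (length l)) (cong (x +_) (psum-nthOr l))

  -- Column weights of a sequence cs of columns: weights cs lists the
  -- numbers of ones per column, and for n′ + 1 columns  weight cs i  is
  -- the weight of column i read cyclically, a function of period n′ + 1
  -- to which the cycle lemma applies.
  weights : ∀ {m} → Vec (Vec Bool c) m → List ℕ
  weights cs = toList (V.map onesRow cs)

  weight : Vec (Vec Bool c) (suc n′) → ℕ → ℕ
  weight cs i = onesRow (head (rotateN i cs))

  weight-rotateN : ∀ s (cs : Vec (Vec Bool c) (suc n′)) i → weight (rotateN s cs) i ≡ weight cs (i + s)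
  weight-rotateN s cs i = cong (λ xs → onesRow (head xs)) (rotateN-+ i s cs)

  weight-periodic : ∀ (cs : Vec (Vec Bool c) (suc n′)) i → weight cs (i + suc n′) ≡ weight cs i
  weight-periodic {n′ = n′} cs i = cong (λ xs → onesRow (head xs))
    (trans (cong (λ s → rotateN (i + s) cs) (sym (*-identityˡ (suc n′)))) (rotateN-mod i 1 cs))

  weight-nth : ∀ (cs : Vec (Vec Bool c) (suc n′)) i → i < suc n′ → weight cs i ≡ nthOr 0 (weights cs) i
  weight-nth cs i i<n = begin
      onesRow (head (rotateN i cs))                         ≡⟨ head-map (rotateN i cs) ⟩
      nthOr 0 (toList (V.map onesRow (rotateN i cs))) 0      ≡⟨ cong (λ xs → nthOr 0 (toList xs) 0) (sym (rotateN-map i onesRow cs)) ⟩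
      nthOr 0 (toList (rotateN i (V.map onesRow cs))) 0      ≡⟨ cong (λ l → nthOr 0 l 0) (toList-rotateN i (V.map onesRow cs)) ⟩
      nthOr 0 (rotateLN i (weights cs)) 0                    ≡⟨ nthOr-rotateLN 0 i (weights cs) i<len ⟩
      nthOr 0 (weights cs) i                                 ∎
    where
    open ≡-Reasoning
    head-map : ∀ {m} (xs : Vec (Vec Bool c) (suc m)) → onesRow (head xs) ≡ nthOr 0 (toList (V.map onesRow xs)) 0
    head-map (x ∷ xs) = refl
    i<len : i < length (weights cs)
    i<len = subst (i <_) (sym (length-toList (V.map onesRow cs))) i<n

  ones-weights : ∀ {m} (cs : Vec (Vec Bool c) m) → ones cs ≡ sum (weights cs)
  ones-weights [] = refl
  ones-weights (r ∷ cs) = cong (onesRow r +_) (ones-weights cs)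

  weight-total : ∀ (cs : Vec (Vec Bool c) (suc n′)) → psum (weight cs) (suc n′) ≡ ones cs
  weight-total {n′ = n′} cs = begin
      psum (weight cs) (suc n′)                    ≡⟨ psum-cong (suc n′) (weight-nth cs) ⟩
      psum (nthOr 0 (weights cs)) (suc n′)         ≡⟨ cong (psum (nthOr 0 (weights cs))) (sym (length-toList (V.map onesRow cs))) ⟩
      psum (nthOr 0 (weights cs)) (length (weights cs)) ≡⟨ psum-nthOr (weights cs) ⟩
      sum (weights cs)                             ≡⟨ sym (ones-weights cs) ⟩
      ones cs                                      ∎
    where open ≡-Reasoning

  Good : Vec (Vec Bool c) (suc n′) → Set
  Good {n′ = n′} cs = Periodic.Dominating (weight cs) (suc n′) (weight-periodic cs) 0

  module _ (cs : Vec (Vec Bool c) (suc n′)) where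
    open Periodic (weight cs) (suc n′) (weight-periodic cs)

    psum-weight-rotateN : ∀ s t → P (s + t) ≡ P s + psum (weight (rotateN s cs)) t
    psum-weight-rotateN s t = trans (psum-split (weight cs) s t)
      (cong (P s +_) (psum-cong t (λ i _ → trans (cong (weight cs) (+-comm s i)) (sym (weight-rotateN s cs i)))))

    good-rotateN⇒ : ∀ s → Good (rotateN s cs) → Dominating s
    good-rotateN⇒ s good t 1≤t t≤n =
      subst (P s + t <_) (sym (psum-weight-rotateN s t)) (+-monoʳ-< (P s) (good t 1≤t t≤n))

    good-rotateN⇐ : ∀ s → Dominating s → Good (rotateN s cs)
    good-rotateN⇐ s dom t 1≤t t≤n =
      +-cancelˡ-< (P s) _ _ (subst (P s + t <_) (psum-weight-rotateN s t) (dom t 1≤t t≤n))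

    -- With n′ + 2 ones in total, the cycle lemma gives a unique good
    -- rotation: the canonical representative of cs up to rotation.
    module _ (total : ones cs ≡ suc (suc n′)) where
      private
        P-total : P (suc n′) ≡ suc (suc n′)
        P-total = trans (weight-total cs) total
        start = dominating-exists P-total n′ refl

      canonical-index : ℕ
      canonical-index = proj₁ start

      canonical-index< : canonical-index < suc n′
      canonical-index< = proj₁ (proj₂ start)

      canonical : Vec (Vec Bool c) (suc n′)
      canonical = rotateN canonical-index cs

      canonical-good : Good canonical
      canonical-good = good-rotateN⇐ canonical-index (proj₂ (proj₂ start))

      canonical-index-unique : ∀ s → s < suc n′ → Good (rotateN s cs) → s ≡ canonical-index
      canonical-index-unique s s<n good =
        dominating-unique P-total s canonical-index s<n canonical-index< (good-rotateN⇒ s good) (proj₂ (proj₂ start))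

      good-rotation-canonical : ∀ s → Good (rotateN s cs) → rotateN s cs ≡ canonical
      good-rotation-canonical s good =
        trans reduce (cong (λ r → rotateN r cs) (canonical-index-unique (s % suc n′) (m%n<n s (suc n′)) (subst Good reduce good)))
        where
        reduce : rotateN s cs ≡ rotateN (s % suc n′) cs
        reduce = trans (cong (λ r → rotateN r cs) (m≡m%n+[m/n]*n s (suc n′))) (rotateN-mod (s % suc n′) (s / suc n′) cs)

  canonical-rotateN : ∀ s (cs : Vec (Vec Bool c) (suc n′)) p p′ → canonical (rotateN s cs) p′ ≡ canonical cs p
  canonical-rotateN s cs p p′ = trans (rotateN-+ r s cs) (good-rotation-canonical cs p (r + s)
    (subst Good (rotateN-+ r s cs) (canonical-good (rotateN s cs) p′)))
    where r = canonical-index (rotateN s cs) p′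

  canonical-cong : ∀ {cs cs′ : Vec (Vec Bool c) (suc n′)} {p p′} → cs ≡ cs′ → canonical cs p ≡ canonical cs′ p′
  canonical-cong {cs = cs} {p = p} {p′} refl = cong (canonical cs) (uip p p′)

  canonical-undo : ∀ (cs : Vec (Vec Bool c) (suc n′)) p → rotateN (suc n′ ∸ canonical-index cs p) (canonical cs p) ≡ cs
  canonical-undo cs p = rotateN-inverse _ (canonical-index cs p) cs (m∸n+n≡m (<⇒≤ (canonical-index< cs p)))

module Bijections where

  open import Data.Nat using (_+_; _*_)
  open import Data.Vec as V using (Vec; []; _∷_; concat; toList)
  open import Data.Vec.Properties using (++-injective; length-toList; toList-cast; toList∘fromList; fromList∘toList)
  open import Data.List using (List; length)
  open import Data.Product using (Σ; _×_; _,_; proj₁; proj₂)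
  open import Function.Bundles using (_↔_; mk↔ₛ′)
  open import Axiom.UniquenessOfIdentityProofs.WithK using (uip)
  open import Relation.Binary.PropositionalEquality

  Σ-≡-irrelevant : ∀ {A : Set} {P : A → Set} → (∀ {a} (p q : P a) → p ≡ q) →
                   ∀ {x y : A} {p : P x} {q : P y} → x ≡ y → _≡_ {A = Σ A P} (x , p) (y , q)
  Σ-≡-irrelevant irrelevant {p = p} {q} refl = cong (_ ,_) (irrelevant p q)

  Σ-≡ : ∀ {A B : Set} {f : A → B} {b : B} {x y : A} {p : f x ≡ b} {q : f y ≡ b} →
        x ≡ y → _≡_ {A = Σ A λ a → f a ≡ b} (x , p) (y , q)
  Σ-≡ = Σ-≡-irrelevant uip

  Σ-implied : ∀ {X : Set} {P R : X → Set} → (∀ x → P x → R x) → (∀ {x} (r r′ : R x) → r ≡ r′) →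
              Σ X P ↔ Σ X (λ x → R x × P x)
  Σ-implied implied irrelevant = mk↔ₛ′ (λ (x , p) → x , implied x p , p) (λ (x , _ , p) → x , p)
    (λ (x , r , p) → cong (λ r′ → x , r′ , p) (irrelevant _ r)) (λ _ → refl)

  ++↔ : ∀ {A : Set} {m n} → (Vec A m × Vec A n) ↔ Vec A (m + n)
  ++↔ {m = m} = mk↔ₛ′ (λ (xs , ys) → xs V.++ ys) (λ v → proj₁ (V.splitAt m v) , proj₁ (proj₂ (V.splitAt m v)))
    (λ v → sym (proj₂ (proj₂ (V.splitAt m v))))
    (λ (xs , ys) → let e = ++-injective xs _ (proj₂ (proj₂ (V.splitAt m (xs V.++ ys)))) in sym (cong₂ _,_ (proj₁ e) (proj₂ e)))

  concat-injective : ∀ {A : Set} {m n} (M M′ : Vec (Vec A n) m) → concat M ≡ concat M′ → M ≡ M′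
  concat-injective [] [] _ = refl
  concat-injective (r ∷ M) (r′ ∷ M′) e with ++-injective r r′ e
  ... | r≡r′ , rest≡ = cong₂ _∷_ r≡r′ (concat-injective M M′ rest≡)

  concat↔ : ∀ {A : Set} {m n} → Vec (Vec A n) m ↔ Vec A (m * n)
  concat↔ {m = m} {n} = mk↔ₛ′ concat (λ v → proj₁ (V.group m n v)) (λ v → sym (proj₂ (V.group m n v)))
    (λ M → concat-injective _ M (sym (proj₂ (V.group m n (concat M)))))

  lists↔Vec : ∀ {A : Set} {L} → Σ (List A) (λ w → length w ≡ L) ↔ Vec A L
  lists↔Vec = mk↔ₛ′ (λ (w , e) → V.cast e (V.fromList w)) (λ v → toList v , length-toList v)
    (λ v → fromList∘toList v) (λ (w , e) → Σ-≡ (trans (toList-cast e (V.fromList w)) (toList∘fromList w)))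

module Counting where

  open Bijections using (concat↔)
  open import Data.Nat
  open import Data.Nat.Properties using (suc-injective)
  open import Data.Nat.Combinatorics using (_C_; nCn≡1; nCk≡nC[n∸k]; k>n⇒nCk≡0; nCk+nC[k+1]≡[n+1]C[k+1])
  open import Data.Bool using (Bool; true; false; if_then_else_)
  open import Data.Fin using (Fin; zero; suc)
  open import Data.Fin.Properties using (+↔⊎)
  open import Data.Vec as V using (Vec; []; _∷_; concat; replicate)
  open import Data.Product using (Σ; ∃; _,_)
  open import Data.Product.Function.Dependent.Propositional using (Σ-↔)
  open import Data.Sum using (_⊎_; inj₁; inj₂)
  open import Data.Sum.Function.Propositional using (_⊎-↔_)
  open import Function using (_∘_)
  open import Function.Bundles using (_↔_; mk↔ₛ′; Inverse)
  open import Function.Properties.Inverse using (↔-refl; ↔-sym; ↔-trans)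
  open import Axiom.UniquenessOfIdentityProofs.WithK using (uip)
  open import Relation.Binary.PropositionalEquality

  binomial : ℕ → ℕ → ℕ
  binomial n zero = 1
  binomial zero (suc k) = 0
  binomial (suc n) (suc k) = binomial n k + binomial n (suc k)

  binomial≡C : ∀ n k → binomial n k ≡ n C k
  binomial≡C zero zero = refl
  binomial≡C zero (suc k) = sym (k>n⇒nCk≡0 {0} {suc k} (s≤s z≤n))
  binomial≡C (suc n) zero = sym (trans (nCk≡nC[n∸k] {0} {suc n} z≤n) (nCn≡1 (suc n)))
  binomial≡C (suc n) (suc k) = trans (cong₂ _+_ (binomial≡C n k) (binomial≡C n (suc k))) (nCk+nC[k+1]≡[n+1]C[k+1] n k)

  Bits : ℕ → ℕ → Set
  Bits L r = Σ (Vec Bool L) λ v → onesRow v ≡ r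

  Bits-cons : ∀ L r → Bits (suc L) (suc r) ↔ (Bits L r ⊎ Bits L (suc r))
  Bits-cons L r = mk↔ₛ′ to from to-from from-to
    where
    to : Bits (suc L) (suc r) → Bits L r ⊎ Bits L (suc r)
    to (true ∷ v , p) = inj₁ (v , suc-injective p)
    to (false ∷ v , p) = inj₂ (v , p)
    from : Bits L r ⊎ Bits L (suc r) → Bits (suc L) (suc r)
    from (inj₁ (v , p)) = true ∷ v , cong suc p
    from (inj₂ (v , p)) = false ∷ v , p
    to-from : ∀ y → to (from y) ≡ y
    to-from (inj₁ (v , refl)) = refl
    to-from (inj₂ (v , p)) = refl
    from-to : ∀ x → from (to x) ≡ x
    from-to (true ∷ v , refl) = refl
    from-to (false ∷ v , p) = refl

  Bits-zero : ∀ L → Bits (suc L) zero ↔ Bits L zero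
  Bits-zero L = mk↔ₛ′ (λ { (false ∷ v , p) → v , p }) (λ (v , p) → false ∷ v , p)
    (λ _ → refl) (λ { (false ∷ v , p) → refl })

  Bits↔binomial : ∀ L r → Bits L r ↔ Fin (binomial L r)
  Bits↔binomial zero zero = mk↔ₛ′ (λ _ → zero) (λ _ → [] , refl) (λ { zero → refl }) (λ { ([] , refl) → refl })
  Bits↔binomial zero (suc r) = mk↔ₛ′ (λ { ([] , ()) }) (λ ()) (λ ()) (λ { ([] , ()) })
  Bits↔binomial (suc L) zero = ↔-trans (Bits-zero L) (Bits↔binomial L zero)
  Bits↔binomial (suc L) (suc r) =
    ↔-trans (Bits-cons L r) (↔-trans (Bits↔binomial L r ⊎-↔ Bits↔binomial L (suc r)) (↔-sym +↔⊎))

  onesRow-replicate : ∀ m → onesRow (replicate m false) ≡ 0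
  onesRow-replicate zero = refl
  onesRow-replicate (suc m) = onesRow-replicate m

  onesRow≡0 : ∀ {m} (v : Vec Bool m) → onesRow v ≡ 0 → v ≡ replicate m false
  onesRow≡0 [] _ = refl
  onesRow≡0 (false ∷ v) v≡0 = cong (false ∷_) (onesRow≡0 v v≡0)

  onesRow-++ : ∀ {a b} (xs : Vec Bool a) (ys : Vec Bool b) → onesRow (xs V.++ ys) ≡ onesRow xs + onesRow ys
  onesRow-++ [] ys = refl
  onesRow-++ (true ∷ xs) ys = cong suc (onesRow-++ xs ys)
  onesRow-++ (false ∷ xs) ys = onesRow-++ xs ys

  ones-concat : ∀ {m n} (M : Matrix m n) → onesRow (concat M) ≡ ones M
  ones-concat [] = refl
  ones-concat (r ∷ M) = trans (onesRow-++ r (concat M)) (cong (onesRow r +_) (ones-concat M))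

  -- Reading a matrix row by row identifies 𝓜^k_n with bit vectors of
  -- length (k + 1) n containing n + 1 ones, so |𝓜^k_n| = ((k+1)n choose n+1).
  MatSet↔Fin : ∀ k n → MatSet k n ↔ Fin ((suc k * n) C (suc n))
  MatSet↔Fin k n = ↔-trans (Σ-↔ concat↔ (λ {A} → ones≡↔ A))
    (subst (λ N → Bits (suc k * n) (suc n) ↔ Fin N) (binomial≡C (suc k * n) (suc n)) (Bits↔binomial (suc k * n) (suc n)))
    where
    ones≡↔ : ∀ (A : Matrix (suc k) n) → (ones A ≡ suc n) ↔ (onesRow (concat A) ≡ suc n)
    ones≡↔ A = subst (λ m → (ones A ≡ suc n) ↔ (m ≡ suc n)) (sym (ones-concat A)) ↔-refl

  count : ∀ m → (Fin m → Bool) → ℕ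
  count zero q = 0
  count (suc m) q = (if q zero then 1 else 0) + count m (q ∘ suc)

  is-true↔ : ∀ b → (b ≡ true) ↔ Fin (if b then 1 else 0)
  is-true↔ true = mk↔ₛ′ (λ _ → zero) (λ _ → refl) (λ { zero → refl }) (λ p → uip refl p)
  is-true↔ false = mk↔ₛ′ (λ ()) (λ ()) (λ ()) (λ ())

  Σ-Fin-suc : ∀ {m} (B : Fin (suc m) → Set) → Σ (Fin (suc m)) B ↔ (B zero ⊎ Σ (Fin m) (B ∘ suc))
  Σ-Fin-suc B = mk↔ₛ′ (λ { (zero , b) → inj₁ b ; (suc i , b) → inj₂ (i , b) })
    (λ { (inj₁ b) → zero , b ; (inj₂ (i , b)) → suc i , b })
    (λ { (inj₁ b) → refl ; (inj₂ (i , b)) → refl }) (λ { (zero , b) → refl ; (suc i , b) → refl })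

  subset↔count : ∀ m (q : Fin m → Bool) → Σ (Fin m) (λ i → q i ≡ true) ↔ Fin (count m q)
  subset↔count zero q = mk↔ₛ′ (λ { (() , _) }) (λ ()) (λ ()) (λ { (() , _) })
  subset↔count (suc m) q = ↔-trans (Σ-Fin-suc (λ i → q i ≡ true))
    (↔-trans (is-true↔ (q zero) ⊎-↔ subset↔count m (q ∘ suc)) (↔-sym +↔⊎))

  finite-subset : ∀ {X : Set} {m} → X ↔ Fin m → (p : X → Bool) → ∃ λ N → Σ X (λ x → p x ≡ true) ↔ Fin N
  finite-subset {m = m} e p =
    count m (p ∘ Inverse.from e) , ↔-trans (↔-sym (Σ-↔ (↔-sym e) ↔-refl)) (subset↔count m (p ∘ Inverse.from e))

module Walks where

  open CycleLemma using (psum; psum-suc)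
  open CanonicalRotation using (weights; nthOr)
  open import Data.Nat
  open import Data.Nat.Properties
  open import Data.Nat.Tactic.RingSolver using (solve-∀)
  open import Data.Nat.ListAction using (sum)
  open import Data.Bool using (Bool; true; false)
  open import Data.Vec as V using (Vec; []; _∷_; toList; concat)
  open import Data.Vec.Properties using (length-toList; toList-++)
  open import Data.List as L using (List; length; _++_)
  open import Data.Maybe using (Maybe; just; nothing; _>>=_)
  import Data.Maybe as Maybe
  open import Data.Product using (Σ; _×_; _,_)
  open import Data.Empty using (⊥; ⊥-elim)
  open import Function.Bundles using (_↔_; mk↔ₛ′)
  open import Relation.Binary.PropositionalEquality

  -- Up-steps and down-steps of a word (true = up, false = down).
  ups : List Bool → ℕ
  ups L.[] = 0
  ups (true L.∷ w) = suc (ups w)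
  ups (false L.∷ w) = ups w

  downs : List Bool → ℕ
  downs L.[] = 0
  downs (true L.∷ w) = downs w
  downs (false L.∷ w) = suc (downs w)

  length-ups-downs : ∀ w → length w ≡ ups w + downs w
  length-ups-downs L.[] = refl
  length-ups-downs (true L.∷ w) = cong suc (length-ups-downs w)
  length-ups-downs (false L.∷ w) = trans (cong suc (length-ups-downs w)) (sym (+-suc _ _))

  ups-toList : ∀ {m} (v : Vec Bool m) → ups (toList v) ≡ onesRow v
  ups-toList [] = refl
  ups-toList (true ∷ v) = cong suc (ups-toList v)
  ups-toList (false ∷ v) = ups-toList v

  -- Level bookkeeping for column weights: from level g, a column of
  -- weight w leads to level g + w - 1, which fails when g + w = 0;
  -- descend g ws is the level reached after columns of weights ws.
  -- (Level g stands for height k + (k + 1) g, see Walk.level below.)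
  descend  : ℕ → List ℕ → Maybe ℕ
  continue : ℕ → List ℕ → Maybe ℕ
  descend g L.[] = just g
  descend g (w L.∷ ws) = continue (g + w) ws
  continue zero ws = nothing
  continue (suc g) ws = descend g ws

  descend-sum : ∀ g ws g′ → descend g ws ≡ just g′ → g′ + length ws ≡ g + sum ws
  descend-sum g L.[] g′ refl = trans (+-identityʳ g) (sym (+-identityʳ g))
  descend-sum g (w L.∷ ws) g′ d with g + w in g+w≡
  ... | suc g″ = begin
      g′ + suc (length ws)   ≡⟨ +-suc g′ (length ws) ⟩
      suc (g′ + length ws)   ≡⟨ cong suc (descend-sum g″ ws g′ d) ⟩
      suc g″ + sum ws        ≡⟨ cong (_+ sum ws) (sym g+w≡) ⟩
      g + w + sum ws         ≡⟨ +-assoc g w (sum ws) ⟩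
      g + (w + sum ws)       ∎
    where open ≡-Reasoning

  PrefixBound : ℕ → List ℕ → Set
  PrefixBound g ws = ∀ t → 1 ≤ t → t ≤ length ws → t ≤ g + psum (nthOr 0 ws) t

  prefix-step : ∀ g w ws {g″} → g + w ≡ suc g″ → ∀ t →
                g + psum (nthOr 0 (w L.∷ ws)) (suc t) ≡ suc (g″ + psum (nthOr 0 ws) t)
  prefix-step g w ws g+w≡ t = trans (cong (g +_) (psum-suc (nthOr 0 (w L.∷ ws)) t))
                                    (trans (sym (+-assoc g w _)) (cong (_+ psum (nthOr 0 ws) t) g+w≡))

  descend⇒bound : ∀ g ws g′ → descend g ws ≡ just g′ → PrefixBound g ws
  descend⇒bound g L.[] g′ d t 1≤t t≤0 = ⊥-elim (<-irrefl refl (≤-trans 1≤t t≤0))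
  descend⇒bound g (w L.∷ ws) g′ d (suc t) 1≤t (s≤s t≤) with g + w in g+w≡
  ... | suc g″ = subst (suc t ≤_) (sym (prefix-step g w ws g+w≡ t)) (s≤s (bound t t≤))
    where
    bound : ∀ t → t ≤ length ws → t ≤ g″ + psum (nthOr 0 ws) t
    bound zero _ = z≤n
    bound (suc t) t≤ = descend⇒bound g″ ws g′ d (suc t) (s≤s z≤n) t≤

  bound⇒descend : ∀ g ws g′ → PrefixBound g ws → g′ + length ws ≡ g + sum ws → descend g ws ≡ just g′
  bound⇒descend g L.[] g′ _ total = cong just (sym (trans (sym (+-identityʳ g′)) (trans total (+-identityʳ g))))
  bound⇒descend g (w L.∷ ws) g′ bound total with g + w in g+w≡
  ... | zero = ⊥-elim (<-irrefl refl (subst (1 ≤_) (trans (cong (g +_) (+-identityˡ w)) g+w≡) (bound 1 ≤-refl (s≤s z≤n))))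
  ... | suc g″ = bound⇒descend g″ ws g′ bound′ total′
    where
    bound′ : PrefixBound g″ ws
    bound′ t 1≤t t≤ = s≤s⁻¹ (subst (suc t ≤_) (prefix-step g w ws g+w≡ t) (bound (suc t) (s≤s z≤n) (s≤s t≤)))
    total′ : g′ + length ws ≡ g″ + sum ws
    total′ = suc-injective (begin
      suc (g′ + length ws)  ≡⟨ sym (+-suc g′ (length ws)) ⟩
      g′ + suc (length ws)  ≡⟨ total ⟩
      g + (w + sum ws)      ≡⟨ sym (+-assoc g w (sum ws)) ⟩
      g + w + sum ws        ≡⟨ cong (_+ sum ws) g+w≡ ⟩
      suc (g″ + sum ws)     ∎)
      where open ≡-Reasoning

  private
    segment-arith : ∀ k u d g → u + d + suc k * g + k * u ≡ suc k * (g + u) + d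
    segment-arith = solve-∀
    tail-arith : ∀ j u d g → let k = j + (u + d) in k + suc k * g + k * u ≡ j + suc k * (g + u) + d
    tail-arith = solve-∀

  module Walk (k : ℕ) where

    walk : ℕ → List Bool → Maybe ℕ
    walk h L.[] = just h
    walk h (true L.∷ w) = walk (h + k) w
    walk zero (false L.∷ w) = nothing
    walk (suc h) (false L.∷ w) = walk h w

    walk-++ : ∀ h xs ys → walk h (xs ++ ys) ≡ (walk h xs >>= λ h′ → walk h′ ys)
    walk-++ h L.[] ys = refl
    walk-++ h (true L.∷ xs) ys = walk-++ (h + k) xs ys
    walk-++ zero (false L.∷ xs) ys = refl
    walk-++ (suc h) (false L.∷ xs) ys = walk-++ h xs ys

    private
      up-height : ∀ h u → h + k * suc u ≡ h + k + k * u
      up-height h u = trans (cong (h +_) (*-suc k u)) (sym (+-assoc h k (k * u)))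

    walk-height : ∀ h w e → walk h w ≡ just e → h + k * ups w ≡ e + downs w
    walk-height h L.[] e refl = cong (h +_) (*-zeroʳ k)
    walk-height h (true L.∷ w) e p = trans (up-height h (ups w)) (walk-height (h + k) w e p)
    walk-height (suc h) (false L.∷ w) e p = trans (cong suc (walk-height h w e p)) (sym (+-suc e _))

    -- A word of length at most h + 1 started at height h can only leave
    -- the half-plane at its very last step, so the height equation alone
    -- decides where it ends.
    walk-short : ∀ h w e → length w ≤ suc h → h + k * ups w ≡ e + downs w → walk h w ≡ just e
    walk-short h L.[] e _ eq = cong just (trans (sym (trans (cong (h +_) (*-zeroʳ k)) (+-identityʳ h))) (trans eq (+-identityʳ _)))
    walk-short h (true L.∷ w) e (s≤s w≤) eq =
      walk-short (h + k) w e (≤-trans w≤ (≤-trans (m≤m+n h k) (n≤1+n _))) (trans (sym (up-height h (ups w))) eq)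
    walk-short zero (false L.∷ L.[]) e _ eq = ⊥-elim (1+n≢0 (sym (trans (sym (*-zeroʳ k)) (trans eq (+-comm e 1)))))
    walk-short zero (false L.∷ _ L.∷ _) e (s≤s ()) eq
    walk-short (suc h) (false L.∷ w) e (s≤s w≤) eq = walk-short h w e w≤ (suc-injective (trans eq (+-suc e _)))

    walk-fails : ∀ h w → (∀ e → h + k * ups w ≡ e + downs w → ⊥) → walk h w ≡ nothing
    walk-fails h w no-end with walk h w in walk≡
    ... | nothing = refl
    ... | just e = ⊥-elim (no-end e (walk-height h w e walk≡))

    PathWord : ℕ → ℕ → ℕ → Set
    PathWord h e u = Σ (List Bool) λ w → walk h w ≡ just e × ups w ≡ u

    Path↔PathWord : ∀ {h e u} → Path k h e u ↔ PathWord h e u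
    Path↔PathWord {h} {e} {u} = mk↔ₛ′ word (λ (w , v , q) → path h e u w v q) (λ (w , v , q) → word-path h e u w v q) path-word
      where
      word : ∀ {h e u} → Path k h e u → PathWord h e u
      word stop = L.[] , refl , refl
      word (up p) with word p
      ... | w , v , q = true L.∷ w , v , cong suc q
      word {suc h} (down p) with word p
      ... | w , v , q = false L.∷ w , v , q
      path : ∀ h e u w → walk h w ≡ just e → ups w ≡ u → Path k h e u
      path h e u L.[] refl refl = stop
      path h e u (true L.∷ w) v refl = up (path (h + k) e (ups w) w v refl)
      path (suc h) e u (false L.∷ w) v q = down (path h e u w v q)
      path-word : ∀ {h e u} (p : Path k h e u) → let (w , v , q) = word p in path h e u w v q ≡ p
      path-word stop = refl
      path-word (up p) with word p | path-word p
      ... | w , v , refl | r = cong up r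
      path-word {suc h} (down p) with word p | path-word p
      ... | w , v , q | r = cong down r
      word-path : ∀ h e u w v q → word (path h e u w v q) ≡ (w , v , q)
      word-path h e u L.[] refl refl = refl
      word-path h e u (true L.∷ w) v refl rewrite word-path (h + k) e (ups w) w v refl = refl
      word-path (suc h) e u (false L.∷ w) v q rewrite word-path h e u w v q = refl

    -- Height k + (k + 1) g is level g; one column of k + 1 steps with w
    -- up-steps changes the level by w - 1, and lower fails below level 0.
    level : ℕ → ℕ
    level g = k + suc k * g

    lower : ℕ → Maybe ℕ
    lower zero = nothing
    lower (suc g) = just g

    walk-segment : ∀ j g w → length w ≡ suc j → walk (j + suc k * g) w ≡ Maybe.map level (lower (g + ups w))
    walk-segment j g w len with g + ups w in g+u≡
    ... | zero = walk-fails _ w no-end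
      where
      no-end : ∀ e → j + suc k * g + k * ups w ≡ e + downs w → ⊥
      no-end e eq = <-irrefl refl (≤-trans (m≤n+m (suc j) e) (≤-reflexive (begin
          e + suc j                        ≡⟨ cong (e +_) (trans (sym len) (trans (length-ups-downs w) (cong (_+ downs w) u≡0))) ⟩
          e + downs w                      ≡⟨ sym eq ⟩
          j + suc k * g + k * ups w        ≡⟨ cong₂ (λ a b → j + suc k * a + k * b) g≡0 u≡0 ⟩
          j + suc k * 0 + k * 0            ≡⟨ cong₂ (λ a b → j + a + b) (*-zeroʳ (suc k)) (*-zeroʳ k) ⟩
          j + 0 + 0                        ≡⟨ trans (+-identityʳ _) (+-identityʳ j) ⟩
          j                                ∎)))
        where
        open ≡-Reasoning
        g≡0 = m+n≡0⇒m≡0 g g+u≡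
        u≡0 = m+n≡0⇒n≡0 g g+u≡
    ... | suc g′ = walk-short _ w _ (≤-trans (≤-reflexive len) (s≤s (m≤m+n j _))) (suc-injective (begin
        suc (j + suc k * g + k * ups w)       ≡⟨ cong (λ m → m + suc k * g + k * ups w) (sym ud) ⟩
        ups w + downs w + suc k * g + k * ups w ≡⟨ segment-arith k (ups w) (downs w) g ⟩
        suc k * (g + ups w) + downs w         ≡⟨ cong (λ m → suc k * m + downs w) g+u≡ ⟩
        suc k * suc g′ + downs w              ≡⟨ cong (_+ downs w) (*-suc (suc k) g′) ⟩
        suc (level g′ + downs w)              ∎))
      where
      open ≡-Reasoning
      ud : ups w + downs w ≡ suc j
      ud = trans (sym (length-ups-downs w)) len

    walk-columns : ∀ g {m} (cs : Vec (Vec Bool (suc k)) m) →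
                   walk (level g) (toList (concat cs)) ≡ Maybe.map level (descend g (weights cs))
    walk-columns g [] = refl
    walk-columns g (c ∷ cs) = begin
        walk (level g) (toList (c V.++ concat cs))
          ≡⟨ cong (walk (level g)) (toList-++ c (concat cs)) ⟩
        walk (level g) (toList c ++ toList (concat cs))
          ≡⟨ walk-++ (level g) (toList c) _ ⟩
        (walk (level g) (toList c) >>= λ h → walk h (toList (concat cs)))
          ≡⟨ cong (_>>= λ h → walk h (toList (concat cs))) (walk-segment k g (toList c) (length-toList c)) ⟩
        (Maybe.map level (lower (g + ups (toList c))) >>= λ h → walk h (toList (concat cs)))
          ≡⟨ cong (λ u → Maybe.map level (lower (g + u)) >>= λ h → walk h (toList (concat cs))) (ups-toList c) ⟩
        (Maybe.map level (lower (g + onesRow c)) >>= λ h → walk h (toList (concat cs)))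
          ≡⟨ after-column (g + onesRow c) ⟩
        Maybe.map level (continue (g + onesRow c) (weights cs))
          ∎
      where
      open ≡-Reasoning
      after-column : ∀ x → (Maybe.map level (lower x) >>= λ h → walk h (toList (concat cs))) ≡ Maybe.map level (continue x (weights cs))
      after-column zero = refl
      after-column (suc g′) = walk-columns g′ cs

    walk-tail : ∀ j g w → j + length w ≡ k → walk (level g) w ≡ just (j + suc k * (g + ups w))
    walk-tail j g w j+len≡k = walk-short _ w _ len≤
      (subst (λ k → k + suc k * g + k * ups w ≡ j + suc k * (g + ups w) + downs w) k≡ (tail-arith j (ups w) (downs w) g))
      where
      k≡ : j + (ups w + downs w) ≡ k
      k≡ = trans (cong (j +_) (sym (length-ups-downs w))) j+len≡k
      len≤ : length w ≤ suc (level g)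
      len≤ = ≤-trans (m≤n+m (length w) j) (≤-trans (≤-reflexive j+len≡k) (≤-trans (m≤m+n k _) (n≤1+n _)))

    walk-glue : ∀ j {m r} (A : Vec Bool (suc j)) (cs : Vec (Vec Bool (suc k)) m) (Z : Vec Bool r) → j + r ≡ k →
                walk j (toList (A V.++ (concat cs V.++ Z))) ≡
                Maybe.map (λ g → j + suc k * (g + onesRow Z)) (descend 0 (onesRow A L.∷ weights cs))
    walk-glue j A cs Z j+r≡k = begin
        walk j (toList (A V.++ (concat cs V.++ Z)))
          ≡⟨ cong (walk j) (trans (toList-++ A _) (cong (toList A ++_) (toList-++ (concat cs) Z))) ⟩
        walk j (toList A ++ rest)
          ≡⟨ walk-++ j (toList A) rest ⟩
        (walk j (toList A) >>= λ h → walk h rest)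
          ≡⟨ cong (_>>= λ h → walk h rest) first-segment ⟩
        (Maybe.map level (lower (onesRow A)) >>= λ h → walk h rest)
          ≡⟨ after-first (onesRow A) ⟩
        Maybe.map end (continue (onesRow A) (weights cs))
          ∎
      where
      open ≡-Reasoning
      rest = toList (concat cs) ++ toList Z
      end = λ g → j + suc k * (g + onesRow Z)
      first-segment : walk j (toList A) ≡ Maybe.map level (lower (onesRow A))
      first-segment = begin
        walk j (toList A)                                  ≡⟨ cong (λ h → walk h (toList A)) (sym (trans (cong (j +_) (*-zeroʳ (suc k))) (+-identityʳ j))) ⟩
        walk (j + suc k * 0) (toList A)                    ≡⟨ walk-segment j 0 (toList A) (length-toList A) ⟩
        Maybe.map level (lower (ups (toList A)))           ≡⟨ cong (λ u → Maybe.map level (lower u)) (ups-toList A) ⟩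
        Maybe.map level (lower (onesRow A))                ∎
      after-columns : ∀ d → (Maybe.map level d >>= λ h → walk h (toList Z)) ≡ Maybe.map end d
      after-columns nothing = refl
      after-columns (just g) = trans (walk-tail j g (toList Z) (trans (cong (j +_) (length-toList Z)) j+r≡k))
                                     (cong (λ u → just (j + suc k * (g + u))) (ups-toList Z))
      after-first : ∀ x → (Maybe.map level (lower x) >>= λ h → walk h rest) ≡ Maybe.map end (continue x (weights cs))
      after-first zero = refl
      after-first (suc g) = begin
        walk (level g) (toList (concat cs) ++ toList Z)                  ≡⟨ walk-++ (level g) (toList (concat cs)) (toList Z) ⟩
        (walk (level g) (toList (concat cs)) >>= λ h → walk h (toList Z)) ≡⟨ cong (_>>= λ h → walk h (toList Z)) (walk-columns g cs) ⟩
        (Maybe.map level (descend g (weights cs)) >>= λ h → walk h (toList Z)) ≡⟨ after-columns (descend g (weights cs)) ⟩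
        Maybe.map end (descend g (weights cs))                            ∎

module ElevatedWords where

  open CanonicalRotation using (weights; ones-weights)
  open Bijections
  open Counting using (onesRow-++; ones-concat; onesRow-replicate; onesRow≡0)
  open Walks
  open import Data.Nat
  open import Data.Nat.Properties
  open import Data.Nat.Tactic.RingSolver using (solve-∀)
  open import Data.Nat.ListAction using (sum)
  open import Data.Bool using (Bool; false)
  open import Data.Vec as V using (Vec; toList; concat; replicate)
  open import Data.Vec.Properties using (length-toList)
  open import Data.List as L using (List; length)
  open import Data.Maybe using (just)
  import Data.Maybe as Maybe
  open import Data.Maybe.Properties using (just-injective)
  open import Data.Product using (Σ; _×_; _,_; proj₁; proj₂)
  open import Data.Product.Algebra using (Σ-assoc)
  open import Data.Product.Function.Dependent.Propositional using (Σ-↔)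
  open import Data.Product.Function.NonDependent.Propositional using (_×-↔_)
  open import Function.Bundles using (_↔_; mk↔ₛ′; Inverse)
  open import Function.Properties.Inverse using (↔-refl; ↔-sym; ↔-trans)
  open import Axiom.UniquenessOfIdentityProofs.WithK using (uip)
  open import Relation.Binary.PropositionalEquality

  module Decomposition (k n′ : ℕ) where
    open Walk k

    ElevatedWord : ℕ → Set
    ElevatedWord j = PathWord j j (suc n′)

    Decomposed : ℕ → Set
    Decomposed j = Σ (Vec Bool (suc j) × Vec (Vec Bool (suc k)) n′) λ (A , cs) →
                     descend 0 (onesRow A L.∷ weights cs) ≡ just 0

    module _ (j : ℕ) (j≤k : j ≤ k) where
      private
        r = k ∸ j
        j+r≡k : j + r ≡ k
        j+r≡k = m+[n∸m]≡n j≤k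

      Pieces : Set
      Pieces = Vec Bool (suc j) × Vec (Vec Bool (suc k)) n′ × Vec Bool r

      glue : Pieces → Vec Bool (suc j + (n′ * suc k + r))
      glue (A , cs , Z) = A V.++ (concat cs V.++ Z)

      pieces↔ : Pieces ↔ Vec Bool (suc j + (n′ * suc k + r))
      pieces↔ = ↔-trans (↔-refl ×-↔ (↔-trans (concat↔ ×-↔ ↔-refl) ++↔)) ++↔

      IsElevated : List Bool → Set
      IsElevated w = walk j w ≡ just j × ups w ≡ suc n′

      IsElevated-irrelevant : ∀ {w} (p q : IsElevated w) → p ≡ q
      IsElevated-irrelevant (p , q) (p′ , q′) = cong₂ _,_ (uip p p′) (uip q q′)

      -- An elevated word has n′ + 1 up-steps and k (n′ + 1) down-steps.
      elevated-length : ∀ w → IsElevated w → length w ≡ suc j + (n′ * suc k + r)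
      elevated-length w (walk≡ , ups≡) = begin
          length w                         ≡⟨ length-ups-downs w ⟩
          ups w + downs w                  ≡⟨ cong₂ _+_ ups≡ (sym downs≡) ⟩
          suc n′ + k * suc n′              ≡⟨ cong (λ k → suc n′ + k * suc n′) (sym j+r≡k) ⟩
          suc n′ + (j + r) * suc n′        ≡⟨ arith n′ j r ⟩
          suc j + (n′ * suc (j + r) + r)   ≡⟨ cong (λ k → suc j + (n′ * suc k + r)) j+r≡k ⟩
          suc j + (n′ * suc k + r)         ∎
        where
        open ≡-Reasoning
        downs≡ : k * suc n′ ≡ downs w
        downs≡ = +-cancelˡ-≡ j _ _ (trans (cong (λ u → j + k * u) (sym ups≡)) (walk-height j w j walk≡))
        arith : ∀ n′ j r → suc n′ + (j + r) * suc n′ ≡ suc j + (n′ * suc (j + r) + r)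
        arith = solve-∀

      glued-elevated⇒ : ∀ A cs Z → IsElevated (toList (glue (A , cs , Z))) →
                        descend 0 (onesRow A L.∷ weights cs) ≡ just 0 × onesRow Z ≡ 0
      glued-elevated⇒ A cs Z (walk≡ , _) = returns (descend 0 (onesRow A L.∷ weights cs)) (trans (sym (walk-glue j A cs Z j+r≡k)) walk≡)
        where
        returns : ∀ d → Maybe.map (λ g → j + suc k * (g + onesRow Z)) d ≡ just j → d ≡ just 0 × onesRow Z ≡ 0
        returns (just g) e = cong just (m+n≡0⇒m≡0 g g+z≡0) , m+n≡0⇒n≡0 g g+z≡0
          where
          g+z≡0 : g + onesRow Z ≡ 0
          g+z≡0 = m*n≡0⇒m≡0 _ (suc k) (trans (*-comm _ (suc k)) (+-cancelˡ-≡ j _ _ (trans (just-injective e) (sym (+-identityʳ j)))))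

      zeros : Vec Bool r
      zeros = replicate r false

      glued-elevated⇐ : ∀ A cs → descend 0 (onesRow A L.∷ weights cs) ≡ just 0 → IsElevated (toList (glue (A , cs , zeros)))
      glued-elevated⇐ A cs d = walk≡ , ups≡
        where
        walk≡ : walk j (toList (glue (A , cs , zeros))) ≡ just j
        walk≡ = begin
          walk j (toList (glue (A , cs , zeros)))                                  ≡⟨ walk-glue j A cs zeros j+r≡k ⟩
          Maybe.map (λ g → j + suc k * (g + onesRow zeros)) (descend 0 (onesRow A L.∷ weights cs)) ≡⟨ cong (Maybe.map _) d ⟩
          just (j + suc k * onesRow zeros)                                          ≡⟨ cong (λ z → just (j + suc k * z)) (onesRow-replicate r) ⟩
          just (j + suc k * 0)                                                      ≡⟨ cong just (trans (cong (j +_) (*-zeroʳ (suc k))) (+-identityʳ j)) ⟩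
          just j                                                                    ∎
          where open ≡-Reasoning
        ups≡ : ups (toList (glue (A , cs , zeros))) ≡ suc n′
        ups≡ = begin
          ups (toList (glue (A , cs , zeros)))          ≡⟨ ups-toList (glue (A , cs , zeros)) ⟩
          onesRow (A V.++ (concat cs V.++ zeros))       ≡⟨ onesRow-++ A _ ⟩
          onesRow A + onesRow (concat cs V.++ zeros)    ≡⟨ cong (onesRow A +_) (onesRow-++ (concat cs) zeros) ⟩
          onesRow A + (onesRow (concat cs) + onesRow zeros) ≡⟨ cong₂ (λ a b → onesRow A + (a + b)) (trans (ones-concat cs) (ones-weights cs)) (onesRow-replicate r) ⟩
          onesRow A + (sum-weights + 0)                 ≡⟨ cong (onesRow A +_) (+-identityʳ _) ⟩
          onesRow A + sum-weights                       ≡⟨ sym (descend-sum 0 (onesRow A L.∷ weights cs) 0 d) ⟩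
          suc (length (weights cs))                     ≡⟨ cong suc (length-toList (V.map onesRow cs)) ⟩
          suc n′                                        ∎
          where
          open ≡-Reasoning
          sum-weights = sum (weights cs)

      -- The tail of an elevated word is forced to be all down-steps, so
      -- elevated glued words are just decompositions.
      glued↔Decomposed : Σ Pieces (λ p → IsElevated (toList (glue p))) ↔ Decomposed j
      glued↔Decomposed = mk↔ₛ′ to from (λ _ → Σ-≡ refl) from-to
        where
        to : Σ Pieces (λ p → IsElevated (toList (glue p))) → Decomposed j
        to ((A , cs , Z) , e) = (A , cs) , proj₁ (glued-elevated⇒ A cs Z e)
        from : Decomposed j → Σ Pieces (λ p → IsElevated (toList (glue p)))
        from ((A , cs) , d) = (A , cs , zeros) , glued-elevated⇐ A cs d
        from-to : ∀ x → from (to x) ≡ x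
        from-to ((A , cs , Z) , e) = Σ-≡-irrelevant (λ {p} → IsElevated-irrelevant {toList (glue p)})
          (cong (λ Z → A , cs , Z) (sym (onesRow≡0 Z (proj₂ (glued-elevated⇒ A cs Z e)))))

      ElevatedWord↔Decomposed : ElevatedWord j ↔ Decomposed j
      ElevatedWord↔Decomposed =
        ↔-trans (Σ-implied elevated-length uip)
        (↔-trans (↔-sym Σ-assoc)
        (↔-trans (↔-sym (Σ-↔ (↔-sym lists↔Vec) ↔-refl))
        (↔-trans (↔-sym (Σ-↔ pieces↔ ↔-refl))
        glued↔Decomposed)))

module GoodSequences where

  open CycleLemma using (psum; psum-suc; psum-cong)
  open CanonicalRotation
  open Bijections using (Σ-≡)
  open Counting using (onesRow-replicate; onesRow≡0)
  open Walks
  open ElevatedWords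
  open import Data.Nat
  open import Data.Nat.Properties
  open import Data.Nat.ListAction using (sum)
  open import Data.Bool using (Bool; true; false)
  open import Data.Fin using (Fin; toℕ; zero; suc)
  open import Data.Vec as V using (Vec; []; _∷_; replicate)
  open import Data.Vec.Properties using (length-toList)
  open import Data.List as L using (List; length)
  open import Data.Maybe using (just)
  open import Data.Product using (Σ; _×_; _,_; proj₁; proj₂)
  open import Data.Bool.Properties using (T-≡)
  open import Data.Empty using (⊥-elim)
  open import Function.Bundles using (_↔_; mk↔ₛ′; Equivalence)
  open import Relation.Nullary using (Dec)
  open import Relation.Nullary.Decidable using (map′; _→-dec_; ⌊_⌋; toWitness; fromWitness)
  open import Axiom.UniquenessOfIdentityProofs.WithK using (uip)
  open import Relation.Binary.PropositionalEquality

  good? : ∀ {c n′} (cs : Vec (Vec Bool c) (suc n′)) → Dec (Good cs)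
  good? {n′ = n′} cs = map′ (λ h t 1≤t t≤n → h (s≤s t≤n) 1≤t) (λ h {t} t<n 1≤t → h t 1≤t (s≤s⁻¹ t<n))
    (allUpTo? (λ t → 1 ≤? t →-dec (psum (weight cs) 0 + t <? psum (weight cs) t)) (suc (suc n′)))

  isGood : ∀ {c n′} → Vec (Vec Bool c) (suc n′) → Bool
  isGood cs = ⌊ good? cs ⌋

  isGood⇒ : ∀ {c n′} (cs : Vec (Vec Bool c) (suc n′)) → isGood cs ≡ true → Good cs
  isGood⇒ cs p = toWitness (Equivalence.from T-≡ p)

  ⇒isGood : ∀ {c n′} (cs : Vec (Vec Bool c) (suc n′)) → Good cs → isGood cs ≡ true
  ⇒isGood cs good = Equivalence.to T-≡ (fromWitness good)

  -- A bit vector of length k + 1 containing a one is determined by the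
  -- position j of its last one together with the j bits before it:
  -- withLastOne and lastOne are mutually inverse on such vectors.
  withLastOne : ∀ {k} (j : Fin (suc k)) → Vec Bool (toℕ j) → Vec Bool (suc k)
  withLastOne zero [] = true ∷ replicate _ false
  withLastOne {suc k} (suc j) (b ∷ A) = b ∷ withLastOne j A

  lastOne : ∀ {k} → Vec Bool (suc k) → Σ (Fin (suc k)) (λ j → Vec Bool (toℕ j))
  lastOne {zero} (b ∷ []) = zero , []
  lastOne {suc k} (b ∷ c) with onesRow c
  ... | zero = zero , []
  ... | suc _ = suc (proj₁ (lastOne c)) , b ∷ proj₂ (lastOne c)

  onesRow-withLastOne : ∀ {k} (j : Fin (suc k)) A → onesRow (withLastOne j A) ≡ suc (onesRow A)
  onesRow-withLastOne {k} zero [] = cong suc (onesRow-replicate k)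
  onesRow-withLastOne {suc k} (suc j) (true ∷ A) = cong suc (onesRow-withLastOne j A)
  onesRow-withLastOne {suc k} (suc j) (false ∷ A) = onesRow-withLastOne j A

  lastOne-withLastOne : ∀ {k} (j : Fin (suc k)) A → lastOne (withLastOne j A) ≡ (j , A)
  lastOne-withLastOne {zero} zero [] = refl
  lastOne-withLastOne {suc k} zero [] rewrite onesRow-replicate (suc k) = refl
  lastOne-withLastOne {suc k} (suc j) (b ∷ A) rewrite onesRow-withLastOne j A | lastOne-withLastOne j A = refl

  withLastOne-lastOne : ∀ {k} (c : Vec Bool (suc k)) → 1 ≤ onesRow c → withLastOne (proj₁ (lastOne c)) (proj₂ (lastOne c)) ≡ c
  withLastOne-lastOne {zero} (true ∷ []) _ = refl
  withLastOne-lastOne {suc k} (b ∷ c) 1≤ with onesRow c in c≡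
  withLastOne-lastOne {suc k} (true ∷ c) _ | zero = cong (true ∷_) (sym (onesRow≡0 c c≡))
  withLastOne-lastOne {suc k} (false ∷ c) 1≤ | zero = ⊥-elim (<-irrefl refl (subst (1 ≤_) c≡ 1≤))
  ... | suc _ = cong (b ∷_) (withLastOne-lastOne c (subst (1 ≤_) (sym c≡) (s≤s z≤n)))

  AboveDiagonal : List ℕ → Set
  AboveDiagonal ws = ∀ t → 1 ≤ t → t ≤ length ws → t < psum (nthOr 0 ws) t

  good⇒above : ∀ {c n′} (cs : Vec (Vec Bool c) (suc n′)) → Good cs → AboveDiagonal (weights cs)
  good⇒above cs good t 1≤t t≤ = subst (t <_) (psum-cong t (λ i i<t → weight-nth cs i (<-≤-trans i<t t≤n))) (good t 1≤t t≤n)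
    where t≤n = subst (t ≤_) (length-toList (V.map onesRow cs)) t≤

  above⇒good : ∀ {c n′} (cs : Vec (Vec Bool c) (suc n′)) → AboveDiagonal (weights cs) → Good cs
  above⇒good cs above t 1≤t t≤n = subst (t <_) (sym (psum-cong t (λ i i<t → weight-nth cs i (<-≤-trans i<t t≤n))))
    (above t 1≤t (subst (t ≤_) (sym (length-toList (V.map onesRow cs))) t≤n))

  -- Removing one from the first weight turns "above the diagonal" into the
  -- prefix bound of descend from level 0.
  psum-first : ∀ u ws t → psum (nthOr 0 (suc u L.∷ ws)) (suc t) ≡ suc (psum (nthOr 0 (u L.∷ ws)) (suc t))
  psum-first u ws t = trans (psum-suc _ t) (cong suc (sym (psum-suc _ t)))

  above⇒bound : ∀ u ws → AboveDiagonal (suc u L.∷ ws) → PrefixBound 0 (u L.∷ ws)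
  above⇒bound u ws above (suc t) _ t≤ = s≤s⁻¹ (subst (suc t <_) (psum-first u ws t) (above (suc t) (s≤s z≤n) t≤))

  bound⇒above : ∀ u ws → PrefixBound 0 (u L.∷ ws) → AboveDiagonal (suc u L.∷ ws)
  bound⇒above u ws bound (suc t) _ t≤ = subst (suc t <_) (sym (psum-first u ws t)) (s≤s (bound (suc t) (s≤s z≤n) t≤))

  -- A good sequence of n′ + 1 columns of height k + 1 with n′ + 2 ones
  -- is the same as a decomposed elevated word: split the first column
  -- b ∷ c at the last one of c; the bits of the first column above that
  -- one form the first segment, and that one itself is dropped.
  module FirstColumn (k″ n′ : ℕ) where
    private k = suc k″
    open Decomposition k n′

    Columns : Set
    Columns = Vec (Vec Bool (suc k)) (suc n′)

    ColumnSeq : Set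
    ColumnSeq = Σ Columns λ cs → ones cs ≡ suc (suc n′)

    GoodSeq : Set
    GoodSeq = Σ ColumnSeq λ x → isGood (proj₁ x) ≡ true

    module _ (c₁ : Vec Bool (suc k)) (rest : Vec (Vec Bool (suc k)) n′) (u : ℕ) (c₁≡ : onesRow c₁ ≡ suc u) where
      private
        ws = weights rest
        length-ws : length ws ≡ n′
        length-ws = length-toList (V.map onesRow rest)
        ones≡ : ones (c₁ ∷ rest) ≡ suc (u + sum ws)
        ones≡ = cong₂ _+_ c₁≡ (ones-weights rest)

      good⇒descend : Good (c₁ ∷ rest) → ones (c₁ ∷ rest) ≡ suc (suc n′) → descend 0 (u L.∷ ws) ≡ just 0
      good⇒descend good total = bound⇒descend 0 (u L.∷ ws) 0
        (above⇒bound u ws (subst (λ w → AboveDiagonal (w L.∷ ws)) c₁≡ (good⇒above (c₁ ∷ rest) good)))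
        (trans (cong suc length-ws) (suc-injective (trans (sym total) ones≡)))

      descend⇒good : descend 0 (u L.∷ ws) ≡ just 0 → Good (c₁ ∷ rest) × ones (c₁ ∷ rest) ≡ suc (suc n′)
      descend⇒good d =
        above⇒good (c₁ ∷ rest) (subst (λ w → AboveDiagonal (w L.∷ ws)) (sym c₁≡) (bound⇒above u ws (descend⇒bound 0 (u L.∷ ws) 0 d))) ,
        trans ones≡ (cong suc (trans (sym (descend-sum 0 (u L.∷ ws) 0 d)) (cong suc length-ws)))

    -- The top bit b of the first column is kept, the marked one is removed.
    onesRow-first : ∀ b (j : Fin k) A → onesRow (b ∷ withLastOne j A) ≡ suc (onesRow (b ∷ A))
    onesRow-first true j A = cong suc (onesRow-withLastOne j A)
    onesRow-first false j A = onesRow-withLastOne j A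

    -- A good first column b ∷ c has at least two ones, so c contains a one.
    first-has-one : ∀ b (c : Vec Bool k) (rest : Vec (Vec Bool (suc k)) n′) → Good ((b ∷ c) ∷ rest) → 1 ≤ onesRow c
    first-has-one b c rest good with good⇒above ((b ∷ c) ∷ rest) good 1 ≤-refl (s≤s z≤n)
    first-has-one true c rest good | s≤s 1≤ = 1≤
    first-has-one false c rest good | 2≤ = <⇒≤ 2≤

    GoodSeq↔Decomposed : GoodSeq ↔ Σ (Fin k) (λ j → Decomposed (toℕ j))
    GoodSeq↔Decomposed = mk↔ₛ′ to from to-from from-to
      where
      to : GoodSeq → Σ (Fin k) (λ j → Decomposed (toℕ j))
      to ((((b ∷ c) ∷ rest) , total) , g) = j , (b ∷ A , rest) , good⇒descend (b ∷ c) rest _ c≡ good total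
        where
        good = isGood⇒ _ g
        j = proj₁ (lastOne c)
        A = proj₂ (lastOne c)
        c≡ : onesRow (b ∷ c) ≡ suc (onesRow (b ∷ A))
        c≡ = trans (cong (λ c → onesRow (b ∷ c)) (sym (withLastOne-lastOne c (first-has-one b c rest good)))) (onesRow-first b j A)
      from : Σ (Fin k) (λ j → Decomposed (toℕ j)) → GoodSeq
      from (j , (b ∷ A , rest) , d) = (cs , proj₂ valid) , ⇒isGood cs (proj₁ valid)
        where
        cs = (b ∷ withLastOne j A) ∷ rest
        valid = descend⇒good (b ∷ withLastOne j A) rest _ (onesRow-first b j A) d
      to-from : ∀ y → to (from y) ≡ y
      to-from (j , (b ∷ A , rest) , d) = same-split (lastOne (withLastOne j A)) (lastOne-withLastOne j A) _
        where
        same-split : ∀ s → s ≡ (j , A) → (d′ : descend 0 (onesRow (b ∷ proj₂ s) L.∷ weights rest) ≡ just 0) →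
                     _≡_ {A = Σ (Fin k) (λ j → Decomposed (toℕ j))} (proj₁ s , (b ∷ proj₂ s , rest) , d′) (j , (b ∷ A , rest) , d)
        same-split s refl d′ = cong (λ d → j , (b ∷ A , rest) , d) (uip d′ d)
      from-to : ∀ x → from (to x) ≡ x
      from-to ((((b ∷ c) ∷ rest) , total) , g) = Σ-≡ (Σ-≡ (cong (λ c → (b ∷ c) ∷ rest)
        (withLastOne-lastOne c (first-has-one b c rest (isGood⇒ _ g)))))

module Main (k″ n′ : ℕ) where

  open Rotations
  open CanonicalRotation
  open Bijections using (Σ-≡)
  open Counting using (MatSet↔Fin; finite-subset)
  open Walks using (module Walk)
  open ElevatedWords
  open GoodSequences
  open import Data.Nat
  open import Data.Nat.Properties
  open import Data.Nat.Combinatorics using (_C_)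
  open import Data.Fin using (Fin; toℕ; fromℕ<)
  open import Data.Fin.Properties using (toℕ-fromℕ<; toℕ-injective; toℕ<n; *↔×)
  open import Data.Fin.Permutation using (↔⇒≡)
  open import Data.Product using (∃; _×_; _,_; proj₁; proj₂)
  open import Data.Product.Function.Dependent.Propositional using (Σ-↔)
  open import Data.Product.Function.NonDependent.Propositional using (_×-↔_)
  open import Function.Bundles using (_↔_; mk↔ₛ′; Inverse; mk⇔)
  open import Function.Properties.Inverse using (↔-refl; ↔-sym; ↔-trans)
  open import Relation.Binary.PropositionalEquality

  private
    k = suc k″
    n = suc n′
  open FirstColumn k″ n′
  open Decomposition k n′

  MatSet↔ColumnSeq : MatSet k n ↔ ColumnSeq
  MatSet↔ColumnSeq = mk↔ₛ′ (λ (A , p) → transpose A , trans (ones-transpose A) p)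
                           (λ (cs , p) → transpose cs , trans (ones-transpose cs) p)
                           (λ (cs , p) → Σ-≡ (transpose-involutive cs))
                           (λ (A , p) → Σ-≡ (transpose-involutive A))

  ColumnSeq↔Fin : ColumnSeq ↔ Fin ((suc k * n) C (suc n))
  ColumnSeq↔Fin = ↔-trans (↔-sym MatSet↔ColumnSeq) (MatSet↔Fin k n)

  -- The number N of good column sequences.  Kept abstract: N is a
  -- huge explicit count that must never be unfolded by the typechecker.
  abstract
    good-finite : ∃ λ N → GoodSeq ↔ Fin N
    good-finite = finite-subset ColumnSeq↔Fin (λ x → isGood (proj₁ x))

  N : ℕ
  N = proj₁ good-finite

  GoodSeq↔Fin : GoodSeq ↔ Fin N
  GoodSeq↔Fin = proj₂ good-finite

  canonicalSeq : ColumnSeq → GoodSeq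
  canonicalSeq (cs , p) = (canonical cs p , trans (ones-rotateN (canonical-index cs p) cs) p) , ⇒isGood _ (canonical-good cs p)

  canonical-of-good : ∀ (g : GoodSeq) → canonicalSeq (proj₁ g) ≡ g
  canonical-of-good ((cs , p) , good) = Σ-≡ (Σ-≡ (sym (good-rotation-canonical cs p 0 (isGood⇒ cs good))))

  -- Every column sequence is, in exactly one way, the rotation of a good
  -- sequence by r ∈ [0, n): hence |ColumnSeq| = n · N.
  ColumnSeq↔GoodSeq×Fin : ColumnSeq ↔ (GoodSeq × Fin n)
  ColumnSeq↔GoodSeq×Fin = mk↔ₛ′ to from to-from from-to
    where
    to : ColumnSeq → GoodSeq × Fin n
    to (cs , p) = canonicalSeq (cs , p) , fromℕ< (canonical-index< cs p)
    from : GoodSeq × Fin n → ColumnSeq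
    from (((cs , p) , _) , r) = rotateN (n ∸ toℕ r) cs , trans (ones-rotateN (n ∸ toℕ r) cs) p
    from-to : ∀ x → from (to x) ≡ x
    from-to (cs , p) = Σ-≡ (trans (cong (λ i → rotateN (n ∸ i) (canonical cs p)) (toℕ-fromℕ< (canonical-index< cs p))) (canonical-undo cs p))
    to-from : ∀ y → to (from y) ≡ y
    to-from (((cs , p) , good) , r) = cong₂ _,_
      (Σ-≡ (Σ-≡ (trans (cong (λ i → rotateN i rotated) (sym index≡)) undo)))
      (toℕ-injective (trans (toℕ-fromℕ< (canonical-index< rotated rotated-ones)) (sym index≡)))
      where
      rotated = rotateN (n ∸ toℕ r) cs
      rotated-ones = trans (ones-rotateN (n ∸ toℕ r) cs) p
      undo : rotateN (toℕ r) rotated ≡ cs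
      undo = rotateN-inverse (toℕ r) (n ∸ toℕ r) cs (m+[n∸m]≡n (<⇒≤ (toℕ<n r)))
      index≡ : toℕ r ≡ canonical-index rotated rotated-ones
      index≡ = canonical-index-unique rotated rotated-ones (toℕ r) (toℕ<n r) (subst Good (sym undo) (isGood⇒ cs good))

  rotation-count : n * N ≡ (suc k * n) C (suc n)
  rotation-count = trans (*-comm n N) (sym (↔⇒≡ (↔-trans (↔-sym ColumnSeq↔Fin)
    (↔-trans ColumnSeq↔GoodSeq×Fin (↔-trans (GoodSeq↔Fin ×-↔ ↔-refl) (↔-sym *↔×))))))

  class : MatSet k n → Fin N
  class x = Inverse.to GoodSeq↔Fin (canonicalSeq (Inverse.to MatSet↔ColumnSeq x))

  class-surjective : ∀ i → ∃ λ x → class x ≡ i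
  class-surjective i = Inverse.from MatSet↔ColumnSeq (proj₁ g) , (begin
      Inverse.to GoodSeq↔Fin (canonicalSeq (Inverse.to MatSet↔ColumnSeq (Inverse.from MatSet↔ColumnSeq (proj₁ g))))
        ≡⟨ cong (λ x → Inverse.to GoodSeq↔Fin (canonicalSeq x)) (Inverse.strictlyInverseˡ MatSet↔ColumnSeq (proj₁ g)) ⟩
      Inverse.to GoodSeq↔Fin (canonicalSeq (proj₁ g))  ≡⟨ cong (Inverse.to GoodSeq↔Fin) (canonical-of-good g) ⟩
      Inverse.to GoodSeq↔Fin g                          ≡⟨ Inverse.strictlyInverseˡ GoodSeq↔Fin i ⟩
      i                                                 ∎)
    where
    open ≡-Reasoning
    g = Inverse.from GoodSeq↔Fin i

  -- Shifting the columns rotates the column sequence, which keeps the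
  -- canonical rotation.
  CPC⇒same-class : ∀ x y → CPC k n x y → class x ≡ class y
  CPC⇒same-class (A , p) (B , q) (s , refl) = cong (Inverse.to GoodSeq↔Fin) (Σ-≡ (Σ-≡ (begin
      canonical cx px             ≡⟨ sym (canonical-rotateN s cx px pr) ⟩
      canonical (rotateN s cx) pr ≡⟨ canonical-cong (sym (transpose-shiftCols s A)) ⟩
      canonical cy py             ∎)))
    where
    open ≡-Reasoning
    cx = transpose A
    px = trans (ones-transpose A) p
    cy = transpose (shiftCols s A)
    py = trans (ones-transpose (shiftCols s A)) q
    pr = trans (ones-rotateN s cx) px

  -- Conversely, sequences with the same canonical rotation are rotations
  -- of each other: undo one canonical rotation after doing the other.
  same-class⇒CPC : ∀ x y → class x ≡ class y → CPC k n x y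
  same-class⇒CPC (A , p) (B , q) same = s , (begin
      B                                          ≡⟨ sym (transpose-involutive B) ⟩
      transpose cy                               ≡⟨ cong transpose cy≡ ⟩
      transpose (rotateN s cx)                   ≡⟨ cong transpose (sym (transpose-shiftCols s A)) ⟩
      transpose (transpose (shiftCols s A))      ≡⟨ transpose-involutive (shiftCols s A) ⟩
      shiftCols s A                              ∎)
    where
    open ≡-Reasoning
    cx = transpose A
    px = trans (ones-transpose A) p
    cy = transpose B
    py = trans (ones-transpose B) q
    same-canonical : canonical cx px ≡ canonical cy py
    same-canonical = cong (λ g → proj₁ (proj₁ g)) (begin
      canonicalSeq (cx , px)                                                             ≡⟨ sym (Inverse.strictlyInverseʳ GoodSeq↔Fin _) ⟩
      Inverse.from GoodSeq↔Fin (class (A , p))                                           ≡⟨ cong (Inverse.from GoodSeq↔Fin) same ⟩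
      Inverse.from GoodSeq↔Fin (class (B , q))                                           ≡⟨ Inverse.strictlyInverseʳ GoodSeq↔Fin _ ⟩
      canonicalSeq (cy , py)                                                             ∎)
    s = n ∸ canonical-index cy py + canonical-index cx px
    cy≡ : cy ≡ rotateN s cx
    cy≡ = begin
      cy                                                          ≡⟨ sym (canonical-undo cy py) ⟩
      rotateN (n ∸ canonical-index cy py) (canonical cy py)        ≡⟨ cong (rotateN (n ∸ canonical-index cy py)) (sym same-canonical) ⟩
      rotateN (n ∸ canonical-index cy py) (canonical cx px)        ≡⟨ rotateN-+ (n ∸ canonical-index cy py) (canonical-index cx px) cx ⟩
      rotateN s cx                                                ∎

  classes : HasClasses (MatSet k n) (CPC k n) N
  classes = class , class-surjective , λ x y → mk⇔ (same-class⇒CPC x y) (CPC⇒same-class x y)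

  Elevated↔Fin : Elevated k n ↔ Fin N
  Elevated↔Fin = ↔-trans (Σ-↔ ↔-refl (λ {j} → ↔-trans (Walk.Path↔PathWord k) (ElevatedWord↔Decomposed (toℕ j) (<⇒≤ (toℕ<n j)))))
                 (↔-trans (↔-sym GoodSeq↔Decomposed) GoodSeq↔Fin)

theorem4p1 : (k n : ℕ) → 1 ≤ k → 1 ≤ n →
    ∃ λ N → (n * N ≡ (suc k * n) C (suc n)) ×
            HasClasses (MatSet k n) (CPC k n) N ×
            (Elevated k n ↔ Fin N)
theorem4p1 (suc k″) (suc n′) _ _ = N , rotation-count , classes , Elevated↔Fin
  where open Main k″ n′
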